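{- Let $q>1$ be an integer all of whose prime factors are at most $w$, and let $a\in\mathbb{Z}$ with $\gcd(a,q)=1$. Then $$\sum_{\substack{z \in [W]\\ z^2 +b_2 \equiv 0 \bmod W}} q^{ -1}S_q(a,z)=0.$$
   Context: Setting: $X$ is a positive integer, $[M]=\{1,\dots,M\}$, $w=\sqrt{\log X}$, $W = 8\prod_{2<p \leq w} p$ (product over primes), and $b_2\in[W]$ with $\gcd(b_2,W)=1$. Let $e(t)=e^{2\pi it}$ and, for $z\in[W]$ with $z^2+b_2\equiv 0\bmod W$, $S_q(a,z)=\sum_{r=1}^q e\bigl(a(Wr^2+2zr+\tfrac{z^2+b_2}{W})/q\bigr)$. -}

module Defs where

open import Data.Nat as ℕ using (ℕ; zero; suc; _≤?_; NonZero)
open import Data.Nat.Primality using (prime?)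
open import Data.Nat.Divisibility using (_∣_; _∣?_; divides)
open import Data.Integer as ℤ using (ℤ; +_)
open import Data.Integer.DivMod using (_%ℕ_)
open import Data.Bool using (if_then_else_; _∧_)
open import Relation.Nullary using (does; Dec; yes; no)
open import Algebra.Bundles using (CommutativeRing)

oddPrimeFactor : ℕ → ℕ
oddPrimeFactor n = if does (prime? n) ∧ does (3 ≤? n) then n else 1

-- ∏_{2 < p ≤ w, p prime} p   (for a natural threshold w = ⌊real w⌋)
oddPrimorial : ℕ → ℕ
oddPrimorial zero    = 1
oddPrimorial (suc n) = oddPrimeFactor (suc n) ℕ.* oddPrimorial n

Wof : ℕ → ℕ
Wof w = 8 ℕ.* oddPrimorial w

module _ {c ℓ} (R : CommutativeRing c ℓ) where
  open CommutativeRing R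

  pow : Carrier → ℕ → Carrier
  pow x zero    = 1#
  pow x (suc n) = x * pow x n

  natCast : ℕ → Carrier
  natCast zero    = 0#
  natCast (suc n) = 1# + natCast n

  sum1 : ℕ → (ℕ → Carrier) → Carrier
  sum1 zero    f = 0#
  sum1 (suc n) f = sum1 n f + f (suc n)

  -- e(t/q) := ζ^(t mod q), where ζ plays the role of e(1/q)
  eq : Carrier → (q : ℕ) → .{{NonZero q}} → ℤ → Carrier
  eq ζ q t = pow ζ (t %ℕ q)

  -- S_q(a,z) with k = (z² + b₂)/W:  Σ_{r=1}^q e(a (W r² + 2 z r + k)/q)
  Sq : Carrier → (q : ℕ) → .{{NonZero q}} → ℤ → (W z k : ℕ) → Carrier
  Sq ζ q a W z k = sum1 q (λ r → eq ζ q (a ℤ.* (+ (W ℕ.* r ℕ.* r ℕ.+ 2 ℕ.* z ℕ.* r ℕ.+ k))))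

  termZ : Carrier → (q : ℕ) → .{{NonZero q}} → ℤ → (W b₂ z : ℕ) → Dec (W ∣ z ℕ.* z ℕ.+ b₂) → Carrier
  termZ ζ q a W b₂ z (yes (divides k _)) = Sq ζ q a W z k
  termZ ζ q a W b₂ z (no _)              = 0#

  totalSum : Carrier → (q : ℕ) → .{{NonZero q}} → ℤ → (W b₂ : ℕ) → Carrier
  totalSum ζ q a W b₂ = sum1 W (λ z → termZ ζ q a W b₂ z (W ∣? (z ℕ.* z ℕ.+ b₂)))

{-# OPTIONS --safe #-}
module Submission where

open import Defs
open import Level using (Level; _⊔_)
open import Data.Bool using (true; false; if_then_else_; _∧_)
open import Data.Nat as ℕ using (ℕ; zero; suc; NonZero; _<_; _≤_; _≤?_; z≤n; s≤s)
import Data.Nat.Properties as ℕ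
open import Data.Nat.Coprimality using (Coprime; gcd≡1⇒coprime)
open import Data.Nat.Divisibility
open import Data.Nat.GCD using (gcd)
open import Data.Nat.ListAction using (product)
open import Data.Nat.Primality
  using (Prime; prime?; ¬prime[1]; prime[2]; euclidsLemma; prime⇒nonTrivial)
open import Data.Nat.Primality.Factorisation using (factorise; PrimeFactorisation)
import Data.Nat.Tactic.RingSolver as ℕ-Solver
open import Data.Integer as ℤ using (ℤ; +_; -[1+_]; ∣_∣)
import Data.Integer.Properties as ℤ
open import Data.Integer.DivMod using (_%ℕ_; _/ℕ_; a≡a%ℕn+[a/ℕn]*n; n%ℕd<d)
import Data.Integer.Divisibility.Signed as ℤ∣
import Data.Integer.Tactic.RingSolver as ℤ-Solver
open import Data.List using ([]; _∷_)
open import Data.List.Relation.Unary.All using (All; _∷_)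
open import Data.Product using (∃-syntax; _×_; _,_)
open import Data.Sum using (_⊎_; inj₁; inj₂)
open import Relation.Nullary using (¬_; yes; no; does; contradiction)
open import Relation.Nullary.Decidable using (dec-true)
open import Relation.Binary.PropositionalEquality as ≡ using (_≡_)
open import Algebra.Bundles using (CommutativeRing)
open import Algebra.Properties.CommutativeSemigroup ℕ.*-commutativeSemigroup using (x∙yz≈y∙xz)
import Algebra.Properties.CommutativeSemigroup as CommutativeSemigroupProperties
import Algebra.Properties.Ring as RingProperties
import Algebra.Properties.Semiring.Exp as SemiringExp
import Relation.Binary.Reasoning.Setoid as SetoidReasoning

-- Write S_q(a,z) = Σ_r χ(P r) with χ n = e(an/q) and P r = W r² + 2zr + k, where W k = z² + b₂.
-- If q has an odd prime factor p, or p = 4 divides q, then p ∣ W, and with q = p s the shift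
-- r ↦ r + s changes P r by 2zs modulo q, so it multiplies every summand by χ(2zs) = e(2az/p);
-- this is a nontrivial root of unity, because p is prime to a, to 2 (or p = 4) and to z (as
-- z² ≡ -b₂ mod W with b₂ prime to W). Each S_q(a,z) therefore vanishes. For q = 2 every
-- S_2(a,z) equals 2χ(k), and z ↦ z + W/2 permutes the roots of z² ≡ -b₂ mod W while replacing
-- k by k + W/4 + z, with W/4 + z odd; as χ of an odd number is -1, the terms cancel in pairs.

module _ {c ℓ} (R : CommutativeRing c ℓ) where
  open CommutativeRing R

  NoZeroDivisors : Set (c ⊔ ℓ)
  NoZeroDivisors = ∀ x y → x * y ≈ 0# → (x ≈ 0#) ⊎ (y ≈ 0#)

  IsRootOfUnity : ℕ → Carrier → Set ℓ
  IsRootOfUnity q ζ = pow R ζ q ≈ 1#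

  IsPrimitive : ℕ → Carrier → Set ℓ
  IsPrimitive q ζ = ∀ k → 0 < k → k < q → ¬ (pow R ζ k ≈ 1#)

module Sum1 {c ℓ} (R : CommutativeRing c ℓ) where
  open CommutativeRing R
  open SetoidReasoning setoid
  open RingProperties ring using (+-cancelʳ)
  open CommutativeSemigroupProperties +-commutativeSemigroup using (interchange; xy∙z≈xz∙y)

  sum1-cong : ∀ n {f g : ℕ → Carrier} → (∀ r → f r ≈ g r) → sum1 R n f ≈ sum1 R n g
  sum1-cong zero    f≈g = refl
  sum1-cong (suc n) f≈g = +-cong (sum1-cong n f≈g) (f≈g (suc n))

  sum1-zero : ∀ n {f : ℕ → Carrier} → (∀ r → f r ≈ 0#) → sum1 R n f ≈ 0#
  sum1-zero zero    f≈0 = refl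
  sum1-zero (suc n) f≈0 = trans (+-cong (sum1-zero n f≈0) (f≈0 (suc n))) (+-identityˡ 0#)

  sum1-distribʳ : ∀ n (f : ℕ → Carrier) x → sum1 R n (λ r → f r * x) ≈ sum1 R n f * x
  sum1-distribʳ zero    f x = sym (zeroˡ x)
  sum1-distribʳ (suc n) f x = trans (+-congʳ (sum1-distribʳ n f x)) (sym (distribʳ x _ _))

  sum1-+ : ∀ n (f g : ℕ → Carrier) → sum1 R n (λ r → f r + g r) ≈ sum1 R n f + sum1 R n g
  sum1-+ zero    f g = sym (+-identityˡ 0#)
  sum1-+ (suc n) f g = trans (+-congʳ (sum1-+ n f g)) (interchange _ _ _ _)

  sum1-+-split : ∀ m n (f : ℕ → Carrier) →
                 sum1 R (m ℕ.+ n) f ≈ sum1 R m f + sum1 R n (λ r → f (m ℕ.+ r))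
  sum1-+-split m zero    f =
    trans (reflexive (≡.cong (λ k → sum1 R k f) (ℕ.+-identityʳ m))) (sym (+-identityʳ _))
  sum1-+-split m (suc n) f = begin
    sum1 R (m ℕ.+ suc n) f
      ≡⟨ ≡.cong (λ k → sum1 R k f) (ℕ.+-suc m n) ⟩
    sum1 R (m ℕ.+ n) f + f (suc (m ℕ.+ n))
      ≈⟨ +-cong (sum1-+-split m n f) (reflexive (≡.cong f (≡.sym (ℕ.+-suc m n)))) ⟩
    sum1 R m f + sum1 R n (λ r → f (m ℕ.+ r)) + f (m ℕ.+ suc n)
      ≈⟨ +-assoc _ _ _ ⟩
    sum1 R m f + sum1 R (suc n) (λ r → f (m ℕ.+ r))
      ∎

  sum1-rotate : ∀ n (f : ℕ → Carrier) →
                sum1 R n (λ r → f (suc r)) + f 1 ≈ sum1 R n f + f (suc n)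
  sum1-rotate zero    f = refl
  sum1-rotate (suc n) f = trans (xy∙z≈xz∙y _ _ _) (+-congʳ (sum1-rotate n f))

  sum1-periodic-shift : ∀ q (f : ℕ → Carrier) → (∀ r → f (r ℕ.+ q) ≈ f r) →
                        ∀ s → sum1 R q (λ r → f (r ℕ.+ s)) ≈ sum1 R q f
  sum1-periodic-shift q f periodic zero =
    sum1-cong q (λ r → reflexive (≡.cong f (ℕ.+-identityʳ r)))
  sum1-periodic-shift q f periodic (suc s) = begin
    sum1 R q (λ r → f (r ℕ.+ suc s)) ≈⟨ sum1-cong q (λ r → reflexive (≡.cong f (ℕ.+-suc r s))) ⟩
    sum1 R q (λ r → g (suc r))        ≈⟨ +-cancelʳ (g 1) _ _ (trans (sum1-rotate q g) (+-congˡ g-wraps)) ⟩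
    sum1 R q g                        ≈⟨ sum1-periodic-shift q f periodic s ⟩
    sum1 R q f                        ∎
    where
    g : ℕ → Carrier
    g r = f (r ℕ.+ s)
    g-wraps : g (suc q) ≈ g 1
    g-wraps = trans (reflexive (≡.cong (λ k → f (suc k)) (ℕ.+-comm q s))) (periodic (suc s))

  sum1-antiperiodic : ∀ n (f : ℕ → Carrier) → (∀ r → f r + f (n ℕ.+ r) ≈ 0#) →
                      sum1 R (n ℕ.+ n) f ≈ 0#
  sum1-antiperiodic n f f+f[n+]≈0 = begin
    sum1 R (n ℕ.+ n) f                        ≈⟨ sum1-+-split n n f ⟩
    sum1 R n f + sum1 R n (λ r → f (n ℕ.+ r)) ≈⟨ sum1-+ n f (λ r → f (n ℕ.+ r)) ⟨
    sum1 R n (λ r → f r + f (n ℕ.+ r))        ≈⟨ sum1-zero n f+f[n+]≈0 ⟩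
    0#                                        ∎

module Domain {c ℓ} (R : CommutativeRing c ℓ) (no-zero-divisors : NoZeroDivisors R) where
  open CommutativeRing R
  open SetoidReasoning setoid
  open RingProperties ring using (x[y-z]≈xy-xz; x∙y⁻¹≈ε⇒x≈y)
  open Sum1 R using (sum1-cong; sum1-distribʳ; sum1-periodic-shift)

  x≈x*y⇒x≈0 : ∀ {x y} → x ≈ x * y → ¬ y ≈ 1# → x ≈ 0#
  x≈x*y⇒x≈0 {x} {y} x≈xy y≉1 with no-zero-divisors x (1# - y) x[1-y]≈0
    where
    x[1-y]≈0 : x * (1# - y) ≈ 0#
    x[1-y]≈0 = begin
      x * (1# - y)   ≈⟨ x[y-z]≈xy-xz x 1# y ⟩
      x * 1# - x * y ≈⟨ +-cong (*-identityʳ x) (-‿cong (sym x≈xy)) ⟩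
      x - x          ≈⟨ -‿inverseʳ x ⟩
      0#             ∎
  ... | inj₁ x≈0   = x≈0
  ... | inj₂ 1-y≈0 = contradiction (sym (x∙y⁻¹≈ε⇒x≈y 1# y 1-y≈0)) y≉1

  x*x≈1⇒x+1≈0 : ∀ {x} → x * x ≈ 1# → ¬ x ≈ 1# → x + 1# ≈ 0#
  x*x≈1⇒x+1≈0 {x} xx≈1 x≉1 = x≈x*y⇒x≈0 x+1≈[x+1]x x≉1
    where
    x+1≈[x+1]x : x + 1# ≈ (x + 1#) * x
    x+1≈[x+1]x = begin
      x + 1#         ≈⟨ +-comm x 1# ⟩
      1# + x         ≈⟨ +-cong xx≈1 (*-identityˡ x) ⟨
      x * x + 1# * x ≈⟨ distribʳ x x 1# ⟨
      (x + 1#) * x   ∎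

  twisted-periodic-sum≈0 : ∀ q s x (f : ℕ → Carrier) → (∀ r → f (r ℕ.+ q) ≈ f r) →
                           (∀ r → f (r ℕ.+ s) ≈ f r * x) → ¬ x ≈ 1# → sum1 R q f ≈ 0#
  twisted-periodic-sum≈0 q s x f periodic twisted x≉1 = x≈x*y⇒x≈0 S≈Sx x≉1
    where
    S≈Sx : sum1 R q f ≈ sum1 R q f * x
    S≈Sx = begin
      sum1 R q f                   ≈⟨ sum1-periodic-shift q f periodic s ⟨
      sum1 R q (λ r → f (r ℕ.+ s)) ≈⟨ sum1-cong q twisted ⟩
      sum1 R q (λ r → f r * x)     ≈⟨ sum1-distribʳ q f x ⟩
      sum1 R q f * x               ∎

module Pow {c ℓ} (R : CommutativeRing c ℓ) where
  open CommutativeRing R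
  open SemiringExp semiring using (_^_; ^-homo-*)

  pow≡^ : ∀ x n → pow R x n ≡ x ^ n
  pow≡^ x zero    = ≡.refl
  pow≡^ x (suc n) = ≡.cong (x *_) (pow≡^ x n)

  pow-+ : ∀ x m n → pow R x (m ℕ.+ n) ≈ pow R x m * pow R x n
  pow-+ x m n rewrite pow≡^ x (m ℕ.+ n) | pow≡^ x m | pow≡^ x n = ^-homo-* x m n

pos-linear : ∀ m k q → + m ℤ.+ + k ℤ.* + q ≡ + (m ℕ.+ k ℕ.* q)
pos-linear m k q =
  ≡.trans (≡.cong (λ v → (+ m) ℤ.+ v) (≡.sym (ℤ.pos-* k q))) (≡.sym (ℤ.pos-+ m (k ℕ.* q)))

difference-mod : ∀ {t} (m d r e q : ℤ) → t ≡ m ℤ.+ d ℤ.* q → t ≡ r ℤ.+ e ℤ.* q →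
                 m ℤ.+ (d ℤ.- e) ℤ.* q ≡ r
difference-mod m d r e q t≡m+dq t≡r+eq = begin
  m ℤ.+ (d ℤ.- e) ℤ.* q       ≡⟨ regroup m d e q ⟩
  (m ℤ.+ d ℤ.* q) ℤ.- e ℤ.* q ≡⟨ ≡.cong (ℤ._- e ℤ.* q) (≡.trans (≡.sym t≡m+dq) t≡r+eq) ⟩
  (r ℤ.+ e ℤ.* q) ℤ.- e ℤ.* q ≡⟨ cancel r e q ⟩
  r                           ∎
  where
  open ≡.≡-Reasoning
  regroup : ∀ m d e q → m ℤ.+ (d ℤ.- e) ℤ.* q ≡ (m ℤ.+ d ℤ.* q) ℤ.- e ℤ.* q
  regroup = ℤ-Solver.solve-∀
  cancel : ∀ r e q → (r ℤ.+ e ℤ.* q) ℤ.- e ℤ.* q ≡ r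
  cancel = ℤ-Solver.solve-∀

module RootOfUnity {c ℓ} (R : CommutativeRing c ℓ) (ζ : CommutativeRing.Carrier R)
                   (q : ℕ) .{{_ : NonZero q}} (ζ^q≈1 : IsRootOfUnity R q ζ) where
  open CommutativeRing R
  open SetoidReasoning setoid
  open Pow R

  pow-*q : ∀ k → pow R ζ (k ℕ.* q) ≈ 1#
  pow-*q zero    = refl
  pow-*q (suc k) = begin
    pow R ζ (q ℕ.+ k ℕ.* q)       ≈⟨ pow-+ ζ q (k ℕ.* q) ⟩
    pow R ζ q * pow R ζ (k ℕ.* q) ≈⟨ *-cong ζ^q≈1 (pow-*q k) ⟩
    1# * 1#                       ≈⟨ *-identityˡ 1# ⟩
    1#                            ∎

  pow-periodic : ∀ n k → pow R ζ (n ℕ.+ k ℕ.* q) ≈ pow R ζ n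
  pow-periodic n k = trans (pow-+ ζ n (k ℕ.* q)) (trans (*-congˡ (pow-*q k)) (*-identityʳ _))

  pow-cong-mod : ∀ m n (d : ℤ) → + m ℤ.+ d ℤ.* + q ≡ + n → pow R ζ m ≈ pow R ζ n
  pow-cong-mod m n (+ k)    m+kq≡n =
    sym (trans (reflexive (≡.cong (pow R ζ) n≡m+kq)) (pow-periodic m k))
    where
    n≡m+kq : n ≡ m ℕ.+ k ℕ.* q
    n≡m+kq = ℤ.+-injective (≡.trans (≡.sym m+kq≡n) (pos-linear m k q))
  pow-cong-mod m n -[1+ k ] m-kq≡n =
    trans (reflexive (≡.cong (pow R ζ) m≡n+kq)) (pow-periodic n (suc k))
    where
    move : ∀ M K Q → M ≡ (M ℤ.+ ℤ.- K ℤ.* Q) ℤ.+ K ℤ.* Q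
    move = ℤ-Solver.solve-∀
    m≡n+kq : m ≡ n ℕ.+ suc k ℕ.* q
    m≡n+kq = ℤ.+-injective (≡.trans (move (+ m) (+ suc k) (+ q))
               (≡.trans (≡.cong (ℤ._+ + suc k ℤ.* + q) m-kq≡n) (pos-linear n (suc k) q)))

  e : ℤ → Carrier
  e = eq R ζ q

  e≈pow : ∀ {t} m (d : ℤ) → t ≡ + m ℤ.+ d ℤ.* + q → e t ≈ pow R ζ m
  e≈pow {t} m d t≡m+dq = sym (pow-cong-mod m (t %ℕ q) (d ℤ.- t /ℕ q)
    (difference-mod (+ m) d (+ (t %ℕ q)) (t /ℕ q) (+ q) t≡m+dq (a≡a%ℕn+[a/ℕn]*n t q)))

  e-+ : ∀ t u → e (t ℤ.+ u) ≈ e t * e u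
  e-+ t u = trans (e≈pow (t %ℕ q ℕ.+ u %ℕ q) (t /ℕ q ℤ.+ u /ℕ q) t+u≡)
                  (pow-+ ζ (t %ℕ q) (u %ℕ q))
    where
    regroup : ∀ r d r′ d′ q →
              (r ℤ.+ d ℤ.* q) ℤ.+ (r′ ℤ.+ d′ ℤ.* q) ≡ (r ℤ.+ r′) ℤ.+ (d ℤ.+ d′) ℤ.* q
    regroup = ℤ-Solver.solve-∀
    t+u≡ : t ℤ.+ u ≡ + (t %ℕ q ℕ.+ u %ℕ q) ℤ.+ (t /ℕ q ℤ.+ u /ℕ q) ℤ.* + q
    t+u≡ = ≡.trans (≡.cong₂ ℤ._+_ (a≡a%ℕn+[a/ℕn]*n t q) (a≡a%ℕn+[a/ℕn]*n u q))
           (≡.trans (regroup (+ (t %ℕ q)) (t /ℕ q) (+ (u %ℕ q)) (u /ℕ q) (+ q))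
                    (≡.cong (ℤ._+ (t /ℕ q ℤ.+ u /ℕ q) ℤ.* + q) (≡.sym (ℤ.pos-+ (t %ℕ q) (u %ℕ q)))))

  e-periodic : ∀ t d → e (t ℤ.+ d ℤ.* + q) ≈ e t
  e-periodic t d = e≈pow (t %ℕ q) (t /ℕ q ℤ.+ d)
    (≡.trans (≡.cong (ℤ._+ d ℤ.* + q) (a≡a%ℕn+[a/ℕn]*n t q)) (regroup (+ (t %ℕ q)) (t /ℕ q) d (+ q)))
    where
    regroup : ∀ r d′ d q → (r ℤ.+ d′ ℤ.* q) ℤ.+ d ℤ.* q ≡ r ℤ.+ (d′ ℤ.+ d) ℤ.* q
    regroup = ℤ-Solver.solve-∀

  e≈1⇒∣ : IsPrimitive R q ζ → ∀ t → e t ≈ 1# → q ∣ ∣ t ∣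
  e≈1⇒∣ ζ-primitive t et≈1 with t %ℕ q in t%q≡ | n%ℕd<d t q
  ... | suc r | r<q = contradiction et≈1 (ζ-primitive (suc r) ℕ.z<s r<q)
  ... | zero  | _   = ℤ∣.∣⇒∣ᵤ (ℤ∣.divides (t /ℕ q) (≡.trans (a≡a%ℕn+[a/ℕn]*n t q)
                        (≡.trans (≡.cong (λ r → + r ℤ.+ (t /ℕ q) ℤ.* + q) t%q≡) (ℤ.+-identityˡ _))))

  module Scaled (a : ℤ) where

    χ : ℕ → Carrier
    χ n = e (a ℤ.* + n)

    χ-0 : χ 0 ≈ 1#
    χ-0 = trans (reflexive (≡.cong e (ℤ.*-zeroʳ a))) (e≈pow 0 (+ 0) ≡.refl)

    χ-+ : ∀ m n → χ (m ℕ.+ n) ≈ χ m * χ n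
    χ-+ m n = trans (reflexive (≡.cong e a[m+n]≡)) (e-+ (a ℤ.* + m) (a ℤ.* + n))
      where
      a[m+n]≡ : a ℤ.* + (m ℕ.+ n) ≡ a ℤ.* + m ℤ.+ a ℤ.* + n
      a[m+n]≡ = ≡.trans (≡.cong (a ℤ.*_) (ℤ.pos-+ m n)) (ℤ.*-distribˡ-+ a (+ m) (+ n))

    χ-+q* : ∀ m n → χ (m ℕ.+ q ℕ.* n) ≈ χ m
    χ-+q* m n = trans (reflexive (≡.cong e a[m+qn]≡)) (e-periodic (a ℤ.* + m) (a ℤ.* + n))
      where
      regroup : ∀ a m n q → a ℤ.* (m ℤ.+ q ℤ.* n) ≡ a ℤ.* m ℤ.+ (a ℤ.* n) ℤ.* q
      regroup = ℤ-Solver.solve-∀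
      a[m+qn]≡ : a ℤ.* + (m ℕ.+ q ℕ.* n) ≡ a ℤ.* + m ℤ.+ (a ℤ.* + n) ℤ.* + q
      a[m+qn]≡ = ≡.trans (≡.cong (a ℤ.*_) (≡.trans (ℤ.pos-+ m (q ℕ.* n))
                                                    (≡.cong (λ v → (+ m) ℤ.+ v) (ℤ.pos-* q n))))
                         (regroup a (+ m) (+ n) (+ q))

    χ≈1⇒∣ : IsPrimitive R q ζ → ∀ n → χ n ≈ 1# → q ∣ ∣ a ∣ ℕ.* n
    χ≈1⇒∣ ζ-primitive n χn≈1 =
      ≡.subst (q ∣_) (ℤ.abs-* a (+ n)) (e≈1⇒∣ ζ-primitive (a ℤ.* + n) χn≈1)

prime-divisor : ∀ {n} → 1 < n → ∃[ p ] Prime p × (p ∣ n)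
prime-divisor {n@(suc _)} 1<n = first-factor (factors f) (isFactorisation f) (factorsPrime f)
  where
  open PrimeFactorisation
  f : PrimeFactorisation n
  f = factorise n
  first-factor : ∀ ps → n ≡ product ps → All Prime ps → ∃[ p ] Prime p × (p ∣ n)
  first-factor []       n≡1 _             = contradiction n≡1 (ℕ.>⇒≢ 1<n)
  first-factor (p ∷ ps) n≡  (p-prime ∷ _) =
    p , p-prime , ≡.subst (p ∣_) (≡.sym n≡) (m∣m*n (product ps))

odd-prime-divisor-or-even : ∀ {n} → 1 < n → (∃[ p ] Prime p × 3 ≤ p × (p ∣ n)) ⊎ 2 ∣ n
odd-prime-divisor-or-even 1<n with prime-divisor 1<n
... | p , p-prime , p∣n with p ℕ.≟ 2
...   | yes ≡.refl = inj₂ p∣n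
...   | no p≢2     = inj₁ (p , p-prime , 3≤p , p∣n)
  where
  3≤p : 3 ≤ p
  3≤p = ℕ.≤∧≢⇒< (ℕ.nonTrivial⇒n>1 p {{prime⇒nonTrivial p-prime}}) (≡.≢-sym p≢2)

odd-prime-divisor-or-4∣-or-≡2 : ∀ {n} → 1 < n → (∃[ p ] Prime p × 3 ≤ p × (p ∣ n)) ⊎ 4 ∣ n ⊎ n ≡ 2
odd-prime-divisor-or-4∣-or-≡2 1<n with odd-prime-divisor-or-even 1<n
... | inj₁ odd                = inj₁ odd
... | inj₂ (divides 0 ≡.refl) = contradiction 1<n λ ()
... | inj₂ (divides 1 ≡.refl) = inj₂ (inj₂ ≡.refl)
... | inj₂ (divides m@(suc (suc _)) ≡.refl) with odd-prime-divisor-or-even {m} (s≤s (s≤s z≤n))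
...   | inj₁ (p , p-prime , 3≤p , p∣m) = inj₁ (p , p-prime , 3≤p , ∣m⇒∣m*n 2 p∣m)
...   | inj₂ 2∣m                        = inj₂ (inj₁ (*-monoˡ-∣ 2 2∣m))

coprime⇒prime∤ : ∀ {m n p} → Coprime m n → Prime p → p ∣ n → ¬ p ∣ m
coprime⇒prime∤ coprime p-prime p∣n p∣m = ¬prime[1] (≡.subst Prime (coprime (p∣m , p∣n)) p-prime)

prime∤root : ∀ {b W z p} → Coprime b W → Prime p → p ∣ W → W ∣ z ℕ.* z ℕ.+ b → ¬ p ∣ z
prime∤root {z = z} coprime p-prime p∣W W∣z²+b p∣z =
  coprime⇒prime∤ coprime p-prime p∣W (∣m+n∣m⇒∣n (∣-trans p∣W W∣z²+b) (∣m⇒∣m*n z p∣z))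

oddPrimeFactor-prime : ∀ {p} → Prime p → 3 ≤ p → oddPrimeFactor p ≡ p
oddPrimeFactor-prime {p} p-prime 3≤p
  rewrite dec-true (prime? p) p-prime | dec-true (3 ≤? p) 3≤p = ≡.refl

oddPrimeFactor-nonZero : ∀ n → NonZero (oddPrimeFactor n)
oddPrimeFactor-nonZero zero    = _
oddPrimeFactor-nonZero (suc m) = if-nonZero (does (prime? (suc m)) ∧ does (3 ≤? suc m))
  where
  if-nonZero : ∀ b → NonZero (if b then suc m else 1)
  if-nonZero true  = _
  if-nonZero false = _

oddPrimorial-nonZero : ∀ w → NonZero (oddPrimorial w)
oddPrimorial-nonZero zero    = _
oddPrimorial-nonZero (suc w) =
  ℕ.m*n≢0 _ _ {{oddPrimeFactor-nonZero (suc w)}} {{oddPrimorial-nonZero w}}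

∣oddPrimorial : ∀ {p} w → Prime p → 3 ≤ p → p ≤ w → p ∣ oddPrimorial w
∣oddPrimorial zero    p-prime 3≤p p≤0 = contradiction (ℕ.≤-trans 3≤p p≤0) λ ()
∣oddPrimorial {p} (suc w) p-prime 3≤p p≤1+w with p ℕ.≟ suc w
... | yes ≡.refl =
  ∣m⇒∣m*n (oddPrimorial w) (∣-reflexive (≡.sym (oddPrimeFactor-prime p-prime 3≤p)))
... | no p≢1+w   = ∣n⇒∣m*n (oddPrimeFactor (suc w))
  (∣oddPrimorial w p-prime 3≤p (ℕ.≤-pred (ℕ.≤∧≢⇒< p≤1+w p≢1+w)))

TwistingDivisor : (q W b A p : ℕ) → Set
TwistingDivisor q W b A p = (p ∣ q) × (p ∣ W) × (∀ z → W ∣ z ℕ.* z ℕ.+ b → ¬ p ∣ A ℕ.* (2 ℕ.* z))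

twistingDivisor⊎≡2 : ∀ {q w b A} → 1 < q → (∀ p → Prime p → p ∣ q → p ≤ w) →
                     Coprime b (Wof w) → Coprime A q →
                     (∃[ p ] TwistingDivisor q (Wof w) b A p) ⊎ q ≡ 2
twistingDivisor⊎≡2 {q} {w} {b} {A} 1<q q-smooth b⊥W A⊥q with odd-prime-divisor-or-4∣-or-≡2 1<q
... | inj₁ (p , p-prime , 3≤p , p∣q) = inj₁ (p , p∣q , p∣W , p∤A*2z)
  where
  p∣W : p ∣ Wof w
  p∣W = ∣n⇒∣m*n 8 (∣oddPrimorial w p-prime 3≤p (q-smooth p p-prime p∣q))
  p∤A*2z : ∀ z → Wof w ∣ z ℕ.* z ℕ.+ b → ¬ p ∣ A ℕ.* (2 ℕ.* z)
  p∤A*2z z W∣z²+b p∣A*2z with euclidsLemma A (2 ℕ.* z) p-prime p∣A*2z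
  ... | inj₁ p∣A  = coprime⇒prime∤ A⊥q p-prime p∣q p∣A
  ... | inj₂ p∣2z with euclidsLemma 2 z p-prime p∣2z
  ...   | inj₁ p∣2 = contradiction (ℕ.≤-trans 3≤p (∣⇒≤ p∣2)) λ { (s≤s (s≤s ())) }
  ...   | inj₂ p∣z = prime∤root b⊥W p-prime p∣W W∣z²+b p∣z
... | inj₂ (inj₁ 4∣q) = inj₁ (4 , 4∣q , ∣m⇒∣m*n (oddPrimorial w) (divides 2 ≡.refl) , 4∤A*2z)
  where
  4∤A*2z : ∀ z → Wof w ∣ z ℕ.* z ℕ.+ b → ¬ 4 ∣ A ℕ.* (2 ℕ.* z)
  4∤A*2z z W∣z²+b 4∣A*2z
    with euclidsLemma A z prime[2] (*-cancelˡ-∣ 2 (≡.subst (4 ∣_) (x∙yz≈y∙xz A 2 z) 4∣A*2z))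
  ... | inj₁ 2∣A = coprime⇒prime∤ A⊥q prime[2] (∣-trans (divides 2 ≡.refl) 4∣q) 2∣A
  ... | inj₂ 2∣z = prime∤root b⊥W prime[2] (∣m⇒∣m*n (oddPrimorial w) (divides 4 ≡.refl)) W∣z²+b 2∣z
... | inj₂ (inj₂ q≡2) = inj₂ q≡2

quadratic : ℕ → ℕ → ℕ → ℕ → ℕ
quadratic W z k r = W ℕ.* r ℕ.* r ℕ.+ 2 ℕ.* z ℕ.* r ℕ.+ k

quadratic-+ : ∀ W z k r s → quadratic W z k (r ℕ.+ s)
                             ≡ quadratic W z k r ℕ.+ s ℕ.* (2 ℕ.* z ℕ.+ W ℕ.* (2 ℕ.* r ℕ.+ s))
quadratic-+ = expand
  where
  expand : ∀ W z k r s → W ℕ.* (r ℕ.+ s) ℕ.* (r ℕ.+ s) ℕ.+ 2 ℕ.* z ℕ.* (r ℕ.+ s) ℕ.+ k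
                         ≡ W ℕ.* r ℕ.* r ℕ.+ 2 ℕ.* z ℕ.* r ℕ.+ k
                             ℕ.+ s ℕ.* (2 ℕ.* z ℕ.+ W ℕ.* (2 ℕ.* r ℕ.+ s))
  expand = ℕ-Solver.solve-∀

module QuadraticGaussSum {c ℓ} (R : CommutativeRing c ℓ) (no-zero-divisors : NoZeroDivisors R)
  (ζ : CommutativeRing.Carrier R) (q : ℕ) .{{_ : NonZero q}}
  (ζ^q≈1 : IsRootOfUnity R q ζ) (ζ-primitive : IsPrimitive R q ζ) (a : ℤ) where
  open CommutativeRing R
  open Domain R no-zero-divisors using (twisted-periodic-sum≈0)
  open Sum1 R using (sum1-zero)
  open RootOfUnity R ζ q ζ^q≈1 using (module Scaled)
  open Scaled a

  Sq≈0 : ∀ W z k p → p ∣ q → p ∣ W → ¬ p ∣ ∣ a ∣ ℕ.* (2 ℕ.* z) → Sq R ζ q a W z k ≈ 0#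
  Sq≈0 .(d ℕ.* p) z k p (divides s q≡sp) (divides d ≡.refl) p∤a2z =
    twisted-periodic-sum≈0 q s (χ (2 ℕ.* z ℕ.* s)) f periodic twisted twist≉1
    where
    W : ℕ
    W = d ℕ.* p
    f : ℕ → Carrier
    f r = χ (quadratic W z k r)
    periodic : ∀ r → f (r ℕ.+ q) ≈ f r
    periodic r = trans (reflexive (≡.cong χ (quadratic-+ W z k r q))) (χ-+q* (quadratic W z k r) _)
    expand : ∀ d p z r s → s ℕ.* (2 ℕ.* z ℕ.+ d ℕ.* p ℕ.* (2 ℕ.* r ℕ.+ s))
                           ≡ 2 ℕ.* z ℕ.* s ℕ.+ s ℕ.* p ℕ.* (d ℕ.* (2 ℕ.* r ℕ.+ s))
    expand = ℕ-Solver.solve-∀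
    shift : ∀ r → quadratic W z k (r ℕ.+ s)
                  ≡ quadratic W z k r ℕ.+ (2 ℕ.* z ℕ.* s ℕ.+ q ℕ.* (d ℕ.* (2 ℕ.* r ℕ.+ s)))
    shift r = ≡.trans (quadratic-+ W z k r s) (≡.cong (quadratic W z k r ℕ.+_) (≡.trans (expand d p z r s)
                (≡.cong (λ n → 2 ℕ.* z ℕ.* s ℕ.+ n ℕ.* (d ℕ.* (2 ℕ.* r ℕ.+ s))) (≡.sym q≡sp))))
    twisted : ∀ r → f (r ℕ.+ s) ≈ f r * χ (2 ℕ.* z ℕ.* s)
    twisted r = trans (reflexive (≡.cong χ (shift r))) (trans (χ-+ _ _) (*-congˡ (χ-+q* _ _)))
    instance
      s≢0 : NonZero s
      s≢0 = ℕ.≢-nonZero λ s≡0 → ℕ.≢-nonZero⁻¹ q (≡.trans q≡sp (≡.cong (ℕ._* p) s≡0))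
    twist≉1 : ¬ χ (2 ℕ.* z ℕ.* s) ≈ 1#
    twist≉1 twist≈1 = p∤a2z (*-cancelʳ-∣ s (≡.subst₂ _∣_ (≡.trans q≡sp (ℕ.*-comm s p))
      (≡.sym (ℕ.*-assoc ∣ a ∣ (2 ℕ.* z) s)) (χ≈1⇒∣ ζ-primitive (2 ℕ.* z ℕ.* s) twist≈1)))

  totalSum≈0 : ∀ W b p → TwistingDivisor q W b ∣ a ∣ p → totalSum R ζ q a W b ≈ 0#
  totalSum≈0 W b p (p∣q , p∣W , p∤a2z) = sum1-zero W (λ z → termZ≈0 z (W ∣? z ℕ.* z ℕ.+ b))
    where
    termZ≈0 : ∀ z d → termZ R ζ q a W b z d ≈ 0#
    termZ≈0 z (yes W∣z²+b@(divides k _)) = Sq≈0 W z k p p∣q p∣W (p∤a2z z W∣z²+b)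
    termZ≈0 z (no _)                     = refl

square-shift : ∀ V z b → (4 ℕ.* V ℕ.+ z) ℕ.* (4 ℕ.* V ℕ.+ z) ℕ.+ b
                         ≡ (2 ℕ.* V ℕ.+ z) ℕ.* (8 ℕ.* V) ℕ.+ (z ℕ.* z ℕ.+ b)
square-shift = ℕ-Solver.solve-∀

module QuadraticGaussSumModTwo {c ℓ} (R : CommutativeRing c ℓ) (no-zero-divisors : NoZeroDivisors R)
  (ζ : CommutativeRing.Carrier R) (ζ²≈1 : IsRootOfUnity R 2 ζ) (ζ-primitive : IsPrimitive R 2 ζ)
  (a : ℤ) (a-odd : ¬ 2 ∣ ∣ a ∣) (V : ℕ) .{{_ : NonZero V}} (b : ℕ) (b⊥W : Coprime b (8 ℕ.* V)) where
  open CommutativeRing R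
  open SetoidReasoning setoid
  open CommutativeSemigroupProperties +-commutativeSemigroup using (interchange)
  open Domain R no-zero-divisors using (x*x≈1⇒x+1≈0)
  open Sum1 R using (sum1-antiperiodic)
  open RootOfUnity R ζ 2 ζ²≈1 using (module Scaled)
  open Scaled a

  W : ℕ
  W = 8 ℕ.* V

  Sq≈2χk : ∀ z k → Sq R ζ 2 a W z k ≈ χ k + χ k
  Sq≈2χk z k = +-cong (trans (+-identityˡ _) (χ-even 1)) (χ-even 2)
    where
    even : ∀ V z k r → 8 ℕ.* V ℕ.* r ℕ.* r ℕ.+ 2 ℕ.* z ℕ.* r ℕ.+ k
                       ≡ k ℕ.+ 2 ℕ.* (4 ℕ.* V ℕ.* r ℕ.* r ℕ.+ z ℕ.* r)
    even = ℕ-Solver.solve-∀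
    χ-even : ∀ r → χ (quadratic W z k r) ≈ χ k
    χ-even r = trans (reflexive (≡.cong χ (even V z k r))) (χ-+q* k (4 ℕ.* V ℕ.* r ℕ.* r ℕ.+ z ℕ.* r))

  χ[2V+z]+1≈0 : ∀ {z} → W ∣ z ℕ.* z ℕ.+ b → χ (2 ℕ.* V ℕ.+ z) + 1# ≈ 0#
  χ[2V+z]+1≈0 {z} W∣z²+b = x*x≈1⇒x+1≈0 χn*χn≈1 χn≉1
    where
    n : ℕ
    n = 2 ℕ.* V ℕ.+ z
    χn*χn≈1 : χ n * χ n ≈ 1#
    χn*χn≈1 = begin
      χ n * χ n         ≈⟨ χ-+ n n ⟨
      χ (n ℕ.+ n)       ≡⟨ ≡.cong (λ m → χ (n ℕ.+ m)) (ℕ.+-identityʳ n) ⟨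
      χ (0 ℕ.+ 2 ℕ.* n) ≈⟨ χ-+q* 0 n ⟩
      χ 0               ≈⟨ χ-0 ⟩
      1#                ∎
    χn≉1 : ¬ χ n ≈ 1#
    χn≉1 χn≈1 with euclidsLemma ∣ a ∣ n prime[2] (χ≈1⇒∣ ζ-primitive n χn≈1)
    ... | inj₁ 2∣a = a-odd 2∣a
    ... | inj₂ 2∣n = prime∤root b⊥W prime[2] (∣m⇒∣m*n V (divides 4 ≡.refl)) W∣z²+b
                       (∣m+n∣m⇒∣n 2∣n (m∣m*n V))

  summand : ℕ → Carrier
  summand z = termZ R ζ 2 a W b z (W ∣? z ℕ.* z ℕ.+ b)

  summand-antiperiodic : ∀ z → summand z + summand (4 ℕ.* V ℕ.+ z) ≈ 0#
  summand-antiperiodic z = pair (W ∣? z ℕ.* z ℕ.+ b) (W ∣? z′ ℕ.* z′ ℕ.+ b)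
    where
    z′ n : ℕ
    z′ = 4 ℕ.* V ℕ.+ z
    n  = 2 ℕ.* V ℕ.+ z
    shift : z′ ℕ.* z′ ℕ.+ b ≡ n ℕ.* W ℕ.+ (z ℕ.* z ℕ.+ b)
    shift = square-shift V z b
    x+1≈0⇒xy+y≈0 : ∀ {x} y → x + 1# ≈ 0# → x * y + y ≈ 0#
    x+1≈0⇒xy+y≈0 {x} y x+1≈0 = begin
      x * y + y      ≈⟨ +-congˡ (*-identityˡ y) ⟨
      x * y + 1# * y ≈⟨ distribʳ y x 1# ⟨
      (x + 1#) * y   ≈⟨ *-congʳ x+1≈0 ⟩
      0# * y         ≈⟨ zeroˡ y ⟩
      0#             ∎
    pair : ∀ d d′ → termZ R ζ 2 a W b z d + termZ R ζ 2 a W b z′ d′ ≈ 0#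
    pair (yes W∣z²+b@(divides k z²+b≡kW)) (yes (divides k′ z′²+b≡k′W)) = begin
      Sq R ζ 2 a W z k + Sq R ζ 2 a W z′ k′ ≈⟨ +-cong (Sq≈2χk z k) (Sq≈2χk z′ k′) ⟩
      (χ k + χ k) + (χ k′ + χ k′)           ≈⟨ +-comm _ _ ⟩
      (χ k′ + χ k′) + (χ k + χ k)           ≈⟨ +-congʳ (+-cong χk′≈χnχk χk′≈χnχk) ⟩
      (χ n * χ k + χ n * χ k) + (χ k + χ k) ≈⟨ interchange _ _ _ _ ⟩
      (χ n * χ k + χ k) + (χ n * χ k + χ k) ≈⟨ +-cong cancels cancels ⟩
      0# + 0#                               ≈⟨ +-identityʳ 0# ⟩
      0#                                    ∎
      where
      k′≡n+k : k′ ≡ n ℕ.+ k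
      k′≡n+k = ℕ.*-cancelʳ-≡ k′ (n ℕ.+ k) W {{ℕ.m*n≢0 8 V}}
        (≡.trans (≡.sym z′²+b≡k′W) (≡.trans shift
          (≡.trans (≡.cong (n ℕ.* W ℕ.+_) z²+b≡kW) (≡.sym (ℕ.*-distribʳ-+ W n k)))))
      χk′≈χnχk : χ k′ ≈ χ n * χ k
      χk′≈χnχk = trans (reflexive (≡.cong χ k′≡n+k)) (χ-+ n k)
      cancels : χ n * χ k + χ k ≈ 0#
      cancels = x+1≈0⇒xy+y≈0 (χ k) (χ[2V+z]+1≈0 W∣z²+b)
    pair (yes W∣z²+b) (no W∤z′²+b) =
      contradiction (≡.subst (W ∣_) (≡.sym shift) (∣m∣n⇒∣m+n (n∣m*n n) W∣z²+b)) W∤z′²+b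
    pair (no W∤z²+b) (yes W∣z′²+b) =
      contradiction (∣m+n∣m⇒∣n (≡.subst (W ∣_) shift W∣z′²+b) (n∣m*n n)) W∤z²+b
    pair (no _) (no _) = +-identityʳ 0#

  totalSum≈0 : totalSum R ζ 2 a W b ≈ 0#
  totalSum≈0 = begin
    sum1 R W summand                     ≡⟨ ≡.cong (λ m → sum1 R m summand) (ℕ.*-distribʳ-+ V 4 4) ⟩
    sum1 R (4 ℕ.* V ℕ.+ 4 ℕ.* V) summand ≈⟨ sum1-antiperiodic (4 ℕ.* V) summand summand-antiperiodic ⟩
    0#                                   ∎

lemma5p3 : ∀ {c ℓ : Level} (R : CommutativeRing c ℓ) →
    let open CommutativeRing R in
    (∀ x y → x * y ≈ 0# → (x ≈ 0#) ⊎ (y ≈ 0#)) →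
    (∀ n → natCast R n ≈ 0# → n ≡ 0) →
    (ζ : Carrier) → (q : ℕ) → .{{_ : NonZero q}} → 1 < q →
    pow R ζ q ≈ 1# → (∀ k → 0 < k → k < q → ¬ (pow R ζ k ≈ 1#)) →
    (w b₂ : ℕ) → 1 ≤ b₂ → b₂ ≤ Wof w → gcd b₂ (Wof w) ≡ 1 →
    (∀ p → Prime p → p ∣ q → p ≤ w) →
    (a : ℤ) → gcd ∣ a ∣ q ≡ 1 →
    totalSum R ζ q a (Wof w) b₂ ≈ 0#
lemma5p3 R no-zero-divisors _ ζ q 1<q ζ^q≈1 ζ-primitive w b₂ _ _ gcd[b₂,W]≡1 q-smooth a gcd[a,q]≡1
  with twistingDivisor⊎≡2 {A = ∣ a ∣} 1<q q-smooth
         (gcd≡1⇒coprime gcd[b₂,W]≡1) (gcd≡1⇒coprime gcd[a,q]≡1)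
... | inj₁ (p , p-twists) =
  QuadraticGaussSum.totalSum≈0 R no-zero-divisors ζ q ζ^q≈1 ζ-primitive a (Wof w) b₂ p p-twists
... | inj₂ ≡.refl =
  QuadraticGaussSumModTwo.totalSum≈0 R no-zero-divisors ζ ζ^q≈1 ζ-primitive
    a (coprime⇒prime∤ (gcd≡1⇒coprime gcd[a,q]≡1) prime[2] ∣-refl)
    (oddPrimorial w) {{oddPrimorial-nonZero w}} b₂ (gcd≡1⇒coprime gcd[b₂,W]≡1)
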